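{- Let $e$ be a function assigning to each integer $k\geq 1$ a real number $e(k)>0$ such that every graph on $N$ vertices of VC-dimension at most $k$ contains a clique or an independent set of size at least $N^{e(k)}$. Let $d\geq 0$ be an integer, $\alpha,\beta\in\{0,1\}$, and let $A$ be a square $(\alpha,\beta,*)$-matrix of size $n$ of VC-dimension at most $d$. Then $A$ contains, for some $\gamma\in\{0,1\}$, a square $(\alpha,\beta,\gamma)$-submatrix of size at least $n^{e(4d+3)}$.
   Context: A submatrix is obtained by permuting and deleting rows and columns. For $\alpha,\beta,\gamma\in\{0,1\}$, a matrix $M$ is an $(\alpha,\beta,\gamma)$-matrix if $M_{i,j}=\alpha$ for $i<j$, $M_{i,i}=\beta$, and $M_{i,j}=\gamma$ for $i>j$; it is an $(\alpha,\beta,*)$-matrix if the first two conditions hold (entries below the diagonal unrestricted). VC-dimension: for a set system $(X,\mathcal{F})$, $Y\subseteq X$ is shattered if $|\{Y\cap S: S\in\mathcal{F}\}|=2^{|Y|}$, and the VC-dimension is the largest size of a shattered set; for a graph it is applied to its neighbourhood system; for a matrix $A\in\{0,1\}^{m\times n}$ it is the maximum of the VC-dimensions of its column system $([m],\{\{i:A_{i,j}=1\}:j\in[n]\})$ and row system $([n],\{\{j:A_{i,j}=1\}:i\in[m]\})$. (A function $e$ as in the claim exists by a theorem of Nguyen, Scott and Seymour.) -}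

module Defs where

open import Data.Nat using (ℕ; _≤_; _^_)
open import Data.Integer using (∣_∣)
open import Data.Rational using (ℚ; 0ℚ; ↥_; ↧ₙ_) renaming (_<_ to _<ℚ_)
open import Data.Bool using (Bool; true; false)
open import Data.Fin using (Fin; _<_)
open import Data.Fin.Subset using (Subset; _∈_; _⊆_) renaming (∣_∣ to size)
open import Data.Product using (Σ; ∃; _×_)
open import Data.Sum using (_⊎_)
open import Relation.Nullary using (¬_)
open import Relation.Binary.PropositionalEquality using (_≡_; _≢_)
open import Function.Bundles using (_⇔_)
open import Function.Definitions using (Injective)

-- A positive real number e, represented as a Dedekind lower cut
-- L = { q ∈ ℚ | q < e }.
record PosReal : Set₁ where
  field
    Below    : ℚ → Set
    positive : ∃ λ q → (0ℚ <ℚ q) × Below q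
    downward : ∀ p q → p <ℚ q → Below q → Below p
    rounded  : ∀ q → Below q → ∃ λ r → (q <ℚ r) × Below r
    bounded  : ∃ λ q → ¬ Below q
open PosReal public

-- N ^ e ≤ m  (for natural N, m and a positive real e):
-- for every rational q = a / b with 0 < q < e we have N ^ a ≤ m ^ b,
-- i.e. N ^ q ≤ m.  (By continuity this is equivalent to N ^ e ≤ m.)
PowLe : ℕ → PosReal → ℕ → Set
PowLe N e m = ∀ q → 0ℚ <ℚ q → Below e q → N ^ ∣ ↥ q ∣ ≤ m ^ (↧ₙ q)

-- Set system given by an incidence relation: ground set Fin m, one set
-- S_j = { i | inc i j ≡ true } for each j : Fin s.
Shattered : ∀ {m s} → (Fin m → Fin s → Bool) → Subset m → Set
Shattered {m} {s} inc Y =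
  ∀ (Z : Subset m) → Z ⊆ Y →
    ∃ λ (j : Fin s) → ∀ i → i ∈ Y → ((inc i j ≡ true) ⇔ (i ∈ Z))

VCAtMost : ∀ {m s} → (Fin m → Fin s → Bool) → ℕ → Set
VCAtMost {m} inc d = ∀ (Y : Subset m) → Shattered inc Y → size Y ≤ d

record Graph (N : ℕ) : Set where
  field
    adj     : Fin N → Fin N → Bool
    symm    : ∀ u v → adj u v ≡ adj v u
    irrefl  : ∀ v → adj v v ≡ false
open Graph public

GraphVCAtMost : ∀ {N} → Graph N → ℕ → Set
GraphVCAtMost G d = VCAtMost (λ u v → adj G v u) d

IsClique : ∀ {N} → Graph N → Subset N → Set
IsClique G S = ∀ u v → u ∈ S → v ∈ S → u ≢ v → adj G u v ≡ true

IsIndependent : ∀ {N} → Graph N → Subset N → Set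
IsIndependent G S = ∀ u v → u ∈ S → v ∈ S → u ≢ v → adj G u v ≡ false

ErdosHajnalExponent : (ℕ → PosReal) → Set
ErdosHajnalExponent e =
  ∀ (k : ℕ) → 1 ≤ k → ∀ (N : ℕ) (G : Graph N) → GraphVCAtMost G k →
    ∃ λ (S : Subset N) → (IsClique G S × PowLe N (e k) (size S))
                       ⊎ (IsIndependent G S × PowLe N (e k) (size S))


Matrix : ℕ → ℕ → Set
Matrix m n = Fin m → Fin n → Bool

MatrixVCAtMost : ∀ {m n} → Matrix m n → ℕ → Set
MatrixVCAtMost A d = VCAtMost A d × VCAtMost (λ j i → A i j) d

IsABStar : ∀ {n} → Bool → Bool → Matrix n n → Set
IsABStar α β A = (∀ i j → i < j → A i j ≡ α) × (∀ i → A i i ≡ β)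

IsABC : ∀ {n} → Bool → Bool → Bool → Matrix n n → Set
IsABC α β γ A = (∀ i j → i < j → A i j ≡ α) × (∀ i → A i i ≡ β)
              × (∀ i j → j < i → A i j ≡ γ)

-- Square submatrix of size s (permuting and deleting rows/columns):
-- given by injective row and column selections.
Submatrix : ∀ {n} → Matrix n n → (s : ℕ) → (Matrix s s → Set) → Set
Submatrix {n} A s P =
  Σ (Fin s → Fin n) λ r → Σ (Fin s → Fin n) λ c →
    Injective _≡_ _≡_ r × Injective _≡_ _≡_ c × P (λ i j → A (r i) (c j))

-- Order the vertices by index and join u < v exactly when A v u = 1, so a clique or an
-- independent set S of this graph is a set of indices on which every entry of A below
-- the diagonal is the same γ; since A is an (α, β, *)-matrix, S indexes an (α, β, γ)-submatrix.
-- The graph has VC-dimension at most 2d + 1: if Y is shattered by neighbourhoods, split Y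
-- at a threshold t into its first d + 1 elements Y< and the rest Y≥. Either some trace on
-- Y< can be combined with every trace on Y≥ using vertices below t, and then, since a
-- vertex j < i is adjacent to i iff A i j = 1, the columns of A shatter Y≥; or every
-- trace on Y< is realised by a vertex at or above t, and then the rows of A shatter Y<,
-- which is impossible as |Y<| = d + 1.
module Submission where

open import Defs
open import Data.Nat using (ℕ; _+_; _*_)
open import Data.Bool using (Bool)
open import Data.Product using (Σ; ∃; _×_)

open import Data.Nat using (zero; suc; z≤n; s≤s; _≤?_)
  renaming (_≤_ to _≤ℕ_; _<_ to _<ℕ_)
open import Data.Nat.Properties
  using (≤-trans; ≤-reflexive; m≤m+n; m≤n+m; +-suc; +-mono-≤; ≰⇒>; ≮⇒≥; <-≤-trans; n≮0; n≮n)
open import Data.Nat.Tactic.RingSolver using (solve-∀)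
open import Data.Bool using (true; false)
open import Data.Fin using (Fin; toℕ; _<_) renaming (zero to fzero; suc to fsuc)
open import Data.Fin.Properties using (<-cmp; <⇒≢)
open import Data.Fin.Subset using (Subset; inside; outside; _∈_; _∉_; _⊆_; _∩_; _∪_; ∁; ∣_∣)
open import Data.Fin.Subset.Properties
  using (_∈?_; x∈p∩q⁺; x∈p∩q⁻; x∈p∪q⁺; x∈p∪q⁻; x∈∁p⇒x∉p; ∪-comm; anySubset?)
open import Data.Vec using ([]; _∷_; here; there)
open import Data.Product using (_,_; proj₁; proj₂)
open import Data.Sum using (_⊎_; inj₁; inj₂)
open import Data.Empty using (⊥-elim)
open import Relation.Nullary using (¬_; Dec; yes; no; ¬?; contradiction)
open import Relation.Nullary.Decidable using (decidable-stable)
open import Relation.Unary using (Decidable)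
open import Relation.Binary using (tri<; tri≈; tri>)
open import Relation.Binary.PropositionalEquality using (_≡_; _≢_; refl; sym; trans; cong; subst)
open import Function using (_∘_)
open import Function.Bundles using (_⇔_; mk⇔; Equivalence)
open import Function.Construct.Composition using (_⇔-∘_)

private
  variable
    m n s : ℕ

¬∀⟶∃¬-Subset : ∀ {P : Subset n → Set} → Decidable P → ¬ (∀ W → P W) → ∃ (¬_ ∘ P)
¬∀⟶∃¬-Subset P? ¬∀P = decidable-stable (anySubset? (¬? ∘ P?))
  λ ¬∃¬P → ¬∀P λ W → decidable-stable (P? W) (¬∃¬P ∘ (W ,_))

allSubset? : ∀ {P : Subset n → Set} → Decidable P → Dec (∀ W → P W)
allSubset? P? with anySubset? (¬? ∘ P?)
... | yes (W , ¬PW) = no λ ∀P → ¬PW (∀P W)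
... | no ¬∃¬P = yes λ W → decidable-stable (P? W) (¬∃¬P ∘ (W ,_))

∈-∩∪∩ˡ : ∀ {x : Fin n} (p q z w : Subset n) → x ∈ p → x ∉ q → (x ∈ z ∩ p ∪ w ∩ q ⇔ x ∈ z)
∈-∩∪∩ˡ p q z w x∈p x∉q = mk⇔ to (λ x∈z → x∈p∪q⁺ (inj₁ (x∈p∩q⁺ (x∈z , x∈p))))
  where
  to : _ ∈ z ∩ p ∪ w ∩ q → _ ∈ z
  to x∈ with x∈p∪q⁻ (z ∩ p) (w ∩ q) x∈
  ... | inj₁ x∈z∩p = proj₁ (x∈p∩q⁻ z p x∈z∩p)
  ... | inj₂ x∈w∩q = contradiction (proj₂ (x∈p∩q⁻ w q x∈w∩q)) x∉q

∈-∩∪∩ʳ : ∀ {x : Fin n} (p q z w : Subset n) → x ∉ p → x ∈ q → (x ∈ z ∩ p ∪ w ∩ q ⇔ x ∈ w)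
∈-∩∪∩ʳ {x = x} p q z w x∉p x∈q =
  subst (λ r → x ∈ r ⇔ x ∈ w) (∪-comm (w ∩ q) (z ∩ p)) (∈-∩∪∩ˡ q p w z x∈q x∉p)

∣p∩q∣+∣p∩∁q∣≡∣p∣ : (p q : Subset n) → ∣ p ∩ q ∣ + ∣ p ∩ ∁ q ∣ ≡ ∣ p ∣
∣p∩q∣+∣p∩∁q∣≡∣p∣ [] [] = refl
∣p∩q∣+∣p∩∁q∣≡∣p∣ (inside ∷ p) (inside ∷ q) = cong suc (∣p∩q∣+∣p∩∁q∣≡∣p∣ p q)
∣p∩q∣+∣p∩∁q∣≡∣p∣ (inside ∷ p) (outside ∷ q) =
  trans (+-suc ∣ p ∩ q ∣ ∣ p ∩ ∁ q ∣) (cong suc (∣p∩q∣+∣p∩∁q∣≡∣p∣ p q))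
∣p∩q∣+∣p∩∁q∣≡∣p∣ (outside ∷ p) (_ ∷ q) = ∣p∩q∣+∣p∩∁q∣≡∣p∣ p q

below : ∀ n → ℕ → Subset n
below zero    _       = []
below (suc n) zero    = outside ∷ below n zero
below (suc n) (suc t) = inside ∷ below n t

∈below⇔< : ∀ t (i : Fin n) → (i ∈ below n t ⇔ toℕ i <ℕ t)
∈below⇔< t i = mk⇔ (to t i) (from t i)
  where
  to : ∀ {n} t (i : Fin n) → i ∈ below n t → toℕ i <ℕ t
  to zero    (fsuc i) (there i∈) = ⊥-elim (n≮0 (to zero i i∈))
  to (suc t) fzero    _          = s≤s z≤n
  to (suc t) (fsuc i) (there i∈) = s≤s (to t i i∈)
  from : ∀ {n} t (i : Fin n) → toℕ i <ℕ t → i ∈ below n t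
  from (suc t) fzero    _         = here
  from (suc t) (fsuc i) (s≤s i<t) = there (from t i i<t)

∣p∩below0∣≡0 : (p : Subset n) → ∣ p ∩ below n 0 ∣ ≡ 0
∣p∩below0∣≡0 []            = refl
∣p∩below0∣≡0 (inside ∷ p)  = ∣p∩below0∣≡0 p
∣p∩below0∣≡0 (outside ∷ p) = ∣p∩below0∣≡0 p

initial-segment : (p : Subset n) → ∀ k → k ≤ℕ ∣ p ∣ → ∃ λ t → ∣ p ∩ below n t ∣ ≡ k
initial-segment p zero _ = 0 , ∣p∩below0∣≡0 p
initial-segment (inside ∷ p) (suc k) (s≤s k≤∣p∣) =
  let t , ∣p<t∣≡k = initial-segment p k k≤∣p∣ in suc t , cong suc ∣p<t∣≡k
initial-segment (outside ∷ p) (suc k) k≤∣p∣ =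
  let t , ∣p<t∣≡k = initial-segment p (suc k) k≤∣p∣ in suc t , ∣p<t∣≡k

enumerate : (p : Subset n) → Fin ∣ p ∣ → Fin n
enumerate (inside ∷ p) fzero    = fzero
enumerate (inside ∷ p) (fsuc i) = fsuc (enumerate p i)
enumerate (outside ∷ p) i       = fsuc (enumerate p i)

enumerate-∈ : (p : Subset n) (i : Fin ∣ p ∣) → enumerate p i ∈ p
enumerate-∈ (inside ∷ p) fzero    = here
enumerate-∈ (inside ∷ p) (fsuc i) = there (enumerate-∈ p i)
enumerate-∈ (outside ∷ p) i       = there (enumerate-∈ p i)

enumerate-mono-< : (p : Subset n) {i j : Fin ∣ p ∣} → i < j → enumerate p i < enumerate p j
enumerate-mono-< (inside ∷ p) {fzero}  {fsuc j} _         = s≤s z≤n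
enumerate-mono-< (inside ∷ p) {fsuc i} {fsuc j} (s≤s i<j) = s≤s (enumerate-mono-< p i<j)
enumerate-mono-< (outside ∷ p) i<j                        = s≤s (enumerate-mono-< p i<j)

enumerate-injective : (p : Subset n) {i j : Fin ∣ p ∣} → enumerate p i ≡ enumerate p j → i ≡ j
enumerate-injective p {i} {j} eq with <-cmp i j
... | tri< i<j _ _ = contradiction eq (<⇒≢ (enumerate-mono-< p i<j))
... | tri≈ _ i≡j _ = i≡j
... | tri> _ _ j<i = contradiction (sym eq) (<⇒≢ (enumerate-mono-< p j<i))

ShatteredBy : (Fin m → Fin s → Bool) → (Fin s → Set) → Subset m → Set
ShatteredBy {m} inc P Y =
  ∀ (Z : Subset m) → Z ⊆ Y → ∃ λ j → P j × ∀ i → i ∈ Y → ((inc i j ≡ true) ⇔ (i ∈ Z))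

shatteredBy-transfer : ∀ {inc inc′ : Fin m → Fin s → Bool} {P : Fin s → Set} {Y} →
  ShatteredBy inc P Y → (∀ {i j} → i ∈ Y → P j → inc i j ≡ inc′ i j) → Shattered inc′ Y
shatteredBy-transfer sh agree Z Z⊆Y =
  let j , Pj , trace = sh Z Z⊆Y
  in j , λ i i∈Y → trace i i∈Y ⇔-∘ mk⇔ (trans (agree i∈Y Pj)) (trans (sym (agree i∈Y Pj)))

-- Each pair of traces, Z on Y ∩ B and W on Y ∩ ∁ B, is realised by a single member; either
-- some Z combines with every W only through P-members, or each Z has a ¬P-member realiser.
shattered-split : (inc : Fin m → Fin s → Bool) {P : Fin s → Set} → Decidable P →
  (Y B : Subset m) → Shattered inc Y →
  ShatteredBy inc P (Y ∩ ∁ B) ⊎ ShatteredBy inc (¬_ ∘ P) (Y ∩ B)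
shattered-split {m} {s} inc {P} P? Y B shY =
  decide (anySubset? λ Z → allSubset? λ W → P? (realiser Z W))
  where
  Y< Y≥ : Subset m
  Y< = Y ∩ B
  Y≥ = Y ∩ ∁ B
  glued : Subset m → Subset m → Subset m
  glued Z W = Z ∩ Y< ∪ W ∩ Y≥
  glued⊆Y : ∀ Z W → glued Z W ⊆ Y
  glued⊆Y Z W x∈ with x∈p∪q⁻ (Z ∩ Y<) (W ∩ Y≥) x∈
  ... | inj₁ x∈Z∩Y< = proj₁ (x∈p∩q⁻ Y B (proj₂ (x∈p∩q⁻ Z Y< x∈Z∩Y<)))
  ... | inj₂ x∈W∩Y≥ = proj₁ (x∈p∩q⁻ Y (∁ B) (proj₂ (x∈p∩q⁻ W Y≥ x∈W∩Y≥)))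
  realiser : Subset m → Subset m → Fin s
  realiser Z W = proj₁ (shY (glued Z W) (glued⊆Y Z W))
  trace : ∀ Z W i → i ∈ Y → (inc i (realiser Z W) ≡ true ⇔ i ∈ glued Z W)
  trace Z W = proj₂ (shY (glued Z W) (glued⊆Y Z W))
  Y<∌ : ∀ {i} → i ∈ Y≥ → i ∉ Y<
  Y<∌ i∈Y≥ i∈Y< = x∈∁p⇒x∉p (proj₂ (x∈p∩q⁻ Y (∁ B) i∈Y≥)) (proj₂ (x∈p∩q⁻ Y B i∈Y<))
  decide : Dec (∃ λ Z → ∀ W → P (realiser Z W)) →
    ShatteredBy inc P Y≥ ⊎ ShatteredBy inc (¬_ ∘ P) Y<
  decide (yes (Z , ∀P)) = inj₁ λ W _ → realiser Z W , ∀P W , λ i i∈Y≥ →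
    ∈-∩∪∩ʳ Y< Y≥ Z W (Y<∌ i∈Y≥) i∈Y≥ ⇔-∘ trace Z W i (proj₁ (x∈p∩q⁻ Y (∁ B) i∈Y≥))
  decide (no ¬∃) = inj₂ λ Z _ →
    let W , ¬P = ¬∀⟶∃¬-Subset (P? ∘ realiser Z) (¬∃ ∘ (Z ,_))
    in realiser Z W , ¬P , λ i i∈Y< →
      ∈-∩∪∩ˡ Y< Y≥ Z W i∈Y< (λ i∈Y≥ → Y<∌ i∈Y≥ i∈Y<) ⇔-∘ trace Z W i (proj₁ (x∈p∩q⁻ Y B i∈Y<))

lowerTriangle : Matrix n n → Fin n → Fin n → Bool
lowerTriangle A u v with <-cmp u v
... | tri< _ _ _ = A v u
... | tri≈ _ _ _ = false
... | tri> _ _ _ = A u v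

lowerTriangle-< : (A : Matrix n n) {u v : Fin n} → u < v → lowerTriangle A u v ≡ A v u
lowerTriangle-< A {u} {v} u<v with <-cmp u v
... | tri< _ _ _     = refl
... | tri≈ ¬u<v _ _ = contradiction u<v ¬u<v
... | tri> ¬u<v _ _ = contradiction u<v ¬u<v

lowerTriangle-> : (A : Matrix n n) {u v : Fin n} → v < u → lowerTriangle A u v ≡ A u v
lowerTriangle-> A {u} {v} v<u with <-cmp u v
... | tri< _ _ ¬v<u = contradiction v<u ¬v<u
... | tri≈ _ _ ¬v<u = contradiction v<u ¬v<u
... | tri> _ _ _     = refl

lowerTriangleGraph : Matrix n n → Graph n
lowerTriangleGraph A = record { adj = lowerTriangle A ; symm = symmetric ; irrefl = irreflexive }
  where
  irreflexive : ∀ v → lowerTriangle A v v ≡ false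
  irreflexive v with <-cmp v v
  ... | tri< _ v≢v _ = contradiction refl v≢v
  ... | tri≈ _ _ _   = refl
  ... | tri> _ v≢v _ = contradiction refl v≢v
  symmetric : ∀ u v → lowerTriangle A u v ≡ lowerTriangle A v u
  symmetric u v with <-cmp u v
  ... | tri< u<v _ _  = sym (lowerTriangle-> A u<v)
  ... | tri≈ _ refl _ = sym (irreflexive u)
  ... | tri> _ _ v<u  = sym (lowerTriangle-< A v<u)

∈below∧∉below⇒< : ∀ t {i j : Fin n} → i ∈ below n t → j ∉ below n t → i < j
∈below∧∉below⇒< t {i} {j} i∈ j∉ =
  <-≤-trans (Equivalence.to (∈below⇔< t i) i∈) (≮⇒≥ (j∉ ∘ Equivalence.from (∈below⇔< t j)))

lowerTriangleGraph-vc : (A : Matrix n n) (d : ℕ) → MatrixVCAtMost A d →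
  GraphVCAtMost (lowerTriangleGraph A) (suc d + d)
lowerTriangleGraph-vc {n} A d (vcColumns , vcRows) Y shY with ∣ Y ∣ ≤? d
... | yes ∣Y∣≤d = ≤-trans ∣Y∣≤d (m≤n+m d (suc d))
... | no ∣Y∣≰d with initial-segment Y (suc d) (≰⇒> ∣Y∣≰d)
...   | t , ∣Y<∣≡1+d with shattered-split _ (_∈? below n t) Y (below n t) shY
...     | inj₁ shY≥ = subst (_≤ℕ suc d + d) (∣p∩q∣+∣p∩∁q∣≡∣p∣ Y (below n t))
                        (+-mono-≤ (≤-reflexive ∣Y<∣≡1+d) (vcColumns _ (shatteredBy-transfer shY≥ columns)))
  where
  columns : ∀ {i j} → i ∈ Y ∩ ∁ (below n t) → j ∈ below n t → lowerTriangle A j i ≡ A i j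
  columns i∈Y≥ j∈ = lowerTriangle-< A
    (∈below∧∉below⇒< t j∈ (x∈∁p⇒x∉p (proj₂ (x∈p∩q⁻ Y _ i∈Y≥))))
...     | inj₂ shY< = contradiction
                        (subst (_≤ℕ d) ∣Y<∣≡1+d (vcRows _ (shatteredBy-transfer shY< rows))) (n≮n d)
  where
  rows : ∀ {i j} → i ∈ Y ∩ below n t → j ∉ below n t → lowerTriangle A j i ≡ A j i
  rows i∈Y< j∉ = lowerTriangle-> A (∈below∧∉below⇒< t (proj₂ (x∈p∩q⁻ Y _ i∈Y<)) j∉)

homogeneous⇒submatrix : ∀ {α β γ} (A : Matrix n n) → IsABStar α β A → (S : Subset n) →
  (∀ u v → u ∈ S → v ∈ S → u ≢ v → lowerTriangle A u v ≡ γ) → Submatrix A ∣ S ∣ (IsABC α β γ)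
homogeneous⇒submatrix A (above , diagonal) S homogeneous =
  enumerate S , enumerate S , enumerate-injective S , enumerate-injective S ,
  (λ i j i<j → above _ _ (enumerate-mono-< S i<j)) ,
  (λ i → diagonal (enumerate S i)) ,
  λ i j j<i → let ej<ei = enumerate-mono-< S j<i in
    trans (sym (lowerTriangle-> A ej<ei))
          (homogeneous _ _ (enumerate-∈ S i) (enumerate-∈ S j) (<⇒≢ ej<ei ∘ sym))

2d+1≤4d+3 : ∀ d → suc d + d ≤ℕ 4 * d + 3
2d+1≤4d+3 d = ≤-trans (m≤m+n (suc d + d) (2 * d + 2)) (≤-reflexive (identity d))
  where
  identity : ∀ d → (suc d + d) + (2 * d + 2) ≡ 4 * d + 3
  identity = solve-∀

lemma4 : (e : ℕ → PosReal) → ErdosHajnalExponent e →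
    ∀ (d : ℕ) (α β : Bool) (n : ℕ) (A : Matrix n n) →
    IsABStar α β A → MatrixVCAtMost A d →
    ∃ λ (γ : Bool) → ∃ λ (s : ℕ) →
    PowLe n (e (4 * d + 3)) s × Submatrix A s (IsABC α β γ)
lemma4 e erdosHajnal d α β n A A-αβ* vcA
  with erdosHajnal (4 * d + 3) (≤-trans (s≤s z≤n) (m≤n+m 3 (4 * d))) n (lowerTriangleGraph A)
         (λ Y shY → ≤-trans (lowerTriangleGraph-vc A d vcA Y shY) (2d+1≤4d+3 d))
... | S , inj₁ (clique , large) = true  , ∣ S ∣ , large , homogeneous⇒submatrix A A-αβ* S clique
... | S , inj₂ (indep  , large) = false , ∣ S ∣ , large , homogeneous⇒submatrix A A-αβ* S indep
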